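{- For every graph $G$ on $n$ vertices there exists an integer $d$ with $1\le d\le\alpha(G)$ such that \[\chi(G)\le \ln n\cdot\frac{\psi_d(G)}{d}+1 \quad\text{and}\quad \operatorname{rank}(A_G)\ge\nu_d(\psi_d(G))-1.\]
   Context: Graphs are finite, simple and undirected; $A_G$ is the adjacency matrix, $I$ the identity, rank over $\mathbb{R}$; $\alpha,\chi,\omega$ are independence, chromatic and clique numbers; $\ln$ is the natural logarithm. $\psi_d(G)=\max\{|U|: U\subseteq V(G),\ \alpha(G[U])\le d\}$. $\nu_d(m)$ is the minimum of $\operatorname{rank}(A_H+I)$ over all $m$-vertex graphs $H$ with $\omega(H)\le d$. -}

module Defs where

open import Data.Nat as ℕ using (ℕ; zero; suc; _∸_; _^_; _!)
open import Data.Nat.Properties using (_!≢0)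
open import Data.Integer using (+_)
open import Data.Rational using (ℚ; 0ℚ; 1ℚ; _+_; _*_; _/_)
import Data.Rational as ℚ
open import Data.Bool using (Bool; true; false; if_then_else_)
open import Data.Fin using (Fin; zero; suc; _≟_)
open import Data.Fin.Subset using (Subset; _∈_; _∉_; _⊆_; ∣_∣)
open import Data.Product using (Σ; ∃-syntax; _×_)
open import Relation.Binary.PropositionalEquality using (_≡_; _≢_)
open import Relation.Nullary using (does)

record Graph (n : ℕ) : Set where
  field
    adj    : Fin n → Fin n → Bool
    sym    : ∀ i j → adj i j ≡ adj j i
    irrefl : ∀ i → adj i i ≡ false
open Graph public

IsMax : (ℕ → Set) → ℕ → Set
IsMax P k = P k × (∀ m → P m → m ℕ.≤ k)

IsMin : (ℕ → Set) → ℕ → Set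
IsMin P k = P k × (∀ m → P m → k ℕ.≤ m)

module _ {n : ℕ} (G : Graph n) where
  Independent : Subset n → Set
  Independent W = ∀ i j → i ∈ W → j ∈ W → adj G i j ≡ false

  Clique : Subset n → Set
  Clique W = ∀ i j → i ∈ W → j ∈ W → i ≢ j → adj G i j ≡ true

  Colouring : ℕ → Set
  Colouring k = Σ (Fin n → Fin k) λ f → ∀ i j → adj G i j ≡ true → f i ≢ f j

  IsIndependenceNumber : ℕ → Set
  IsIndependenceNumber = IsMax (λ k → ∃[ W ] (Independent W × ∣ W ∣ ≡ k))

  IsChromaticNumber : ℕ → Set
  IsChromaticNumber = IsMin Colouring

  CliqueNumberAtMost : ℕ → Set
  CliqueNumberAtMost d = ∀ W → Clique W → ∣ W ∣ ℕ.≤ d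

  -- α(G[U]) ≤ d : every independent set of the induced subgraph G[U]
  -- (= independent set of G contained in U) has size ≤ d
  InducedIndepAtMost : Subset n → ℕ → Set
  InducedIndepAtMost U d = ∀ W → W ⊆ U → Independent W → ∣ W ∣ ℕ.≤ d

  IsPsi : ℕ → ℕ → Set
  IsPsi d = IsMax (λ k → ∃[ U ] (InducedIndepAtMost U d × ∣ U ∣ ≡ k))

sumℚ : ∀ {n} → (Fin n → ℚ) → ℚ
sumℚ {zero}  f = 0ℚ
sumℚ {suc n} f = f zero + sumℚ (λ i → f (suc i))

Matrix : ℕ → Set
Matrix n = Fin n → Fin n → ℚ

RowsIndependent : ∀ {n} → Matrix n → Subset n → Set
RowsIndependent {n} M S =
  (c : Fin n → ℚ) → (∀ i → i ∉ S → c i ≡ 0ℚ) →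
  (∀ j → sumℚ (λ i → c i * M i j) ≡ 0ℚ) → ∀ i → c i ≡ 0ℚ

-- rank(M) = r  (row rank over ℚ; equals the rank over ℝ for rational matrices)
IsRank : ∀ {n} → Matrix n → ℕ → Set
IsRank M = IsMax (λ k → ∃[ S ] (RowsIndependent M S × ∣ S ∣ ≡ k))

adjMatrix : ∀ {n} → Graph n → Matrix n
adjMatrix G i j = if adj G i j then 1ℚ else 0ℚ

adjMatrixPlusI : ∀ {n} → Graph n → Matrix n
adjMatrixPlusI G i j = adjMatrix G i j + (if does (i ≟ j) then 1ℚ else 0ℚ)

IsNu : ℕ → ℕ → ℕ → Set
IsNu d m = IsMin (λ r → ∃[ H ] (CliqueNumberAtMost {m} H d × IsRank (adjMatrixPlusI H) r))

expPartial : ℕ → ℕ → ℚ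
expPartial a zero    = 1ℚ
expPartial a (suc k) = expPartial a k + (+ (a ^ suc k)) / (suc k !)
  where instance _ = suc k !≢0

-- e^a ≤ N  (exp(a) is the supremum of its increasing partial sums)
ExpLe : ℕ → ℕ → Set
ExpLe a N = ∀ k → expPartial a k ℚ.≤ (+ N) / 1

-- χ ≤ ln n · p / d + 1, for n ≥ 1, d ≥ 1, p ≥ 1, χ ≥ 1.
-- Equivalent to (χ - 1)·d ≤ p · ln n, i.e. e^{(χ-1)d} ≤ n^p.
LnBound : (n c d p : ℕ) → Set
LnBound n c d p = ExpLe ((c ∸ 1) ℕ.* d) (n ^ p)

{-# OPTIONS --safe #-}
-- Colour G greedily: repeatedly remove a maximum independent set W of the remaining vertex
-- set U.  Let d = ∣W₀∣ for the round (U₀, W₀) of smallest ratio ∣W∣/∣U∣.  Then α(G[U₀]) = d,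
-- so p = ψ_d(G) ≥ ∣U₀∣, and every round removes at least the fraction d/p of what is left;
-- hence 1 ≤ n (1 - d/p)^(k-1), where k ≥ χ is the number of rounds.  Comparing the
-- exponential series termwise with the negative binomial series of (1 - d/p)^(-L) gives
-- e^(d/p) ≤ p/(p - d), so e^((χ-1)d) ≤ n^p.
-- For the rank, take U with ∣U∣ = p and α(G[U]) ≤ d: the complement H of G[U] has
-- ω(H) ≤ d and A_H + I = J - A_{G[U]}, while rank(J - A) ≤ rank(A) + 1 and
-- rank(A_{G[U]}) ≤ rank(A_G).
module Submission where

open import Defs hiding (sym)
open import Data.Nat using (ℕ; _≤_; _∸_)
open import Data.Product using (∃-syntax; _×_; _,_)

module ExponentialSeries where

  open import Data.Nat
  open import Data.Nat.Properties
  open import Data.Nat.Tactic.RingSolver using (solve-∀)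
  open import Algebra.Properties.CommutativeSemigroup *-commutativeSemigroup
    using (x∙yz≈y∙xz; x∙yz≈zx∙y; xy∙z≈y∙xz; xy∙z≈xz∙y; interchange)
  open import Relation.Nullary using (contradiction)
  open import Relation.Binary.PropositionalEquality

  -- expNumerator x K = K! · Σ_{i ≤ K} x^i / i!
  expNumerator : ℕ → ℕ → ℕ
  expNumerator x zero    = 1
  expNumerator x (suc K) = suc K * expNumerator x K + x ^ suc K

  -- multichoose L i = C(L + i - 1, i), the coefficient of y^i in (1 - y)^(-L)
  multichoose : ℕ → ℕ → ℕ
  multichoose zero    zero    = 1
  multichoose zero    (suc i) = 0
  multichoose (suc L) zero    = 1
  multichoose (suc L) (suc i) = multichoose L (suc i) + multichoose (suc L) i

  rising : ℕ → ℕ → ℕ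
  rising L zero    = 1
  rising L (suc i) = L * rising (suc L) i

  -- negBinomialNumerator P d L K = P^K · Σ_{i ≤ K} multichoose L i · (d/P)^i
  negBinomialNumerator : ℕ → ℕ → ℕ → ℕ → ℕ
  negBinomialNumerator P d L zero    = 1
  negBinomialNumerator P d L (suc K) =
    P * negBinomialNumerator P d L K + multichoose L (suc K) * d ^ suc K

  ^-distribʳ-* : ∀ m n o → (m * n) ^ o ≡ m ^ o * n ^ o
  ^-distribʳ-* m n zero    = refl
  ^-distribʳ-* m n (suc o) = trans (cong (m * n *_) (^-distribʳ-* m n o)) (interchange m n (m ^ o) (n ^ o))

  expNumerator-zero : ∀ K → expNumerator 0 K ≡ K !
  expNumerator-zero zero    = refl
  expNumerator-zero (suc K) = trans (+-identityʳ _) (cong (suc K *_) (expNumerator-zero K))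

  expNumerator-zero≤ : ∀ P {n} → 1 ≤ n → ∀ K → expNumerator 0 K ≤ n ^ P * K !
  expNumerator-zero≤ P {n} 1≤n K = begin
    expNumerator 0 K  ≡⟨ expNumerator-zero K ⟩
    K !               ≤⟨ m≤n*m (K !) (n ^ P) {{m^n≢0 n P {{>-nonZero 1≤n}}}} ⟩
    n ^ P * K !       ∎
    where open ≤-Reasoning

  expNumerator-monoˡ-≤ : ∀ {x y} → x ≤ y → ∀ K → expNumerator x K ≤ expNumerator y K
  expNumerator-monoˡ-≤ x≤y zero    = ≤-refl
  expNumerator-monoˡ-≤ x≤y (suc K) =
    +-mono-≤ (*-monoʳ-≤ (suc K) (expNumerator-monoˡ-≤ x≤y K)) (^-monoˡ-≤ (suc K) x≤y)

  rising-suc : ∀ L i → L * rising (suc L) i ≡ (L + i) * rising L i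
  rising-suc L zero    = cong (_* 1) (sym (+-identityʳ L))
  rising-suc L (suc i) = begin
    L * (suc L * rising (suc (suc L)) i)  ≡⟨ cong (L *_) (rising-suc (suc L) i) ⟩
    L * ((suc L + i) * rising (suc L) i)  ≡⟨ x∙yz≈y∙xz L (suc L + i) (rising (suc L) i) ⟩
    (suc L + i) * (L * rising (suc L) i)  ≡⟨ cong (_* rising L (suc i)) (+-suc L i) ⟨
    (L + suc i) * rising L (suc i)        ∎
    where open ≡-Reasoning

  factorial*multichoose : ∀ L i → i ! * multichoose L i ≡ rising L i
  factorial*multichoose zero    zero    = refl
  factorial*multichoose zero    (suc i) = *-zeroʳ (suc i !)
  factorial*multichoose (suc L) zero    = refl
  factorial*multichoose (suc L) (suc i) = begin
    suc i ! * (multichoose L (suc i) + multichoose (suc L) i)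
      ≡⟨ regroup (suc i) (i !) (multichoose L (suc i)) (multichoose (suc L) i) ⟩
    suc i ! * multichoose L (suc i) + suc i * (i ! * multichoose (suc L) i)
      ≡⟨ cong₂ (λ a b → a + suc i * b)
               (factorial*multichoose L (suc i)) (factorial*multichoose (suc L) i) ⟩
    L * rising (suc L) i + suc i * rising (suc L) i
      ≡⟨ *-distribʳ-+ (rising (suc L) i) L (suc i) ⟨
    (L + suc i) * rising (suc L) i
      ≡⟨ cong (_* rising (suc L) i) (+-suc L i) ⟩
    (suc L + i) * rising (suc L) i
      ≡⟨ rising-suc (suc L) i ⟨
    rising (suc L) (suc i) ∎
    where
    open ≡-Reasoning
    regroup : ∀ k f a b → (k * f) * (a + b) ≡ (k * f) * a + k * (f * b)
    regroup = solve-∀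

  pow≤rising : ∀ L i → L ^ i ≤ rising L i
  pow≤rising L zero    = ≤-refl
  pow≤rising L (suc i) = *-monoʳ-≤ L (≤-trans (^-monoˡ-≤ i (n≤1+n L)) (pow≤rising (suc L) i))

  pow≤factorial*multichoose : ∀ L i → L ^ i ≤ i ! * multichoose L i
  pow≤factorial*multichoose L i = ≤-trans (pow≤rising L i) (≤-reflexive (sym (factorial*multichoose L i)))

  module _ (q d : ℕ) where

    private
      P : ℕ
      P = q + d

    negBinomialNumerator-zero : ∀ K → negBinomialNumerator P d 0 K ≡ P ^ K
    negBinomialNumerator-zero zero    = refl
    negBinomialNumerator-zero (suc K) = trans (+-identityʳ _) (cong (P *_) (negBinomialNumerator-zero K))

    -- P^(K+1) times the identity, for y = d/P,
    -- (1 - y) Σ_{i ≤ K} multichoose (L+1) i y^i = Σ_{i ≤ K} multichoose L i y^i - multichoose (L+1) K y^(K+1)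
    negBinomialNumerator-suc : ∀ L K →
      q * negBinomialNumerator P d (suc L) K + multichoose (suc L) K * d ^ suc K ≡
      P * negBinomialNumerator P d L K
    negBinomialNumerator-suc L zero    = base q d
      where
      base : ∀ q d → q * 1 + 1 * (d * 1) ≡ (q + d) * 1
      base = solve-∀
    negBinomialNumerator-suc L (suc K) = begin
      q * (P * w + (a + b) * e) + (a + b) * (d * e)  ≡⟨ regroup q d w a b e ⟩
      P * ((q * w + b * e) + a * e)                  ≡⟨ cong (λ z → P * (z + a * e)) (negBinomialNumerator-suc L K) ⟩
      P * (negBinomialNumerator P d L (suc K))       ∎
      where
      open ≡-Reasoning
      w = negBinomialNumerator P d (suc L) K
      a = multichoose L (suc K)
      b = multichoose (suc L) K
      e = d ^ suc K
      regroup : ∀ q d w a b e →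
        q * ((q + d) * w + (a + b) * e) + (a + b) * (d * e) ≡ (q + d) * ((q * w + b * e) + a * e)
      regroup = solve-∀

    negBinomialNumerator-bound : ∀ L K → q ^ L * negBinomialNumerator P d L K ≤ P ^ L * P ^ K
    negBinomialNumerator-bound zero    K = *-monoʳ-≤ 1 (≤-reflexive (negBinomialNumerator-zero K))
    negBinomialNumerator-bound (suc L) K = begin
      q * q ^ L * w                                        ≡⟨ xy∙z≈y∙xz q (q ^ L) w ⟩
      q ^ L * (q * w)                                      ≤⟨ *-monoʳ-≤ (q ^ L) (m≤m+n (q * w) _) ⟩
      q ^ L * (q * w + multichoose (suc L) K * d ^ suc K)  ≡⟨ cong (q ^ L *_) (negBinomialNumerator-suc L K) ⟩
      q ^ L * (P * N)                                      ≡⟨ x∙yz≈y∙xz P (q ^ L) N ⟨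
      P * (q ^ L * N)                                      ≤⟨ *-monoʳ-≤ P (negBinomialNumerator-bound L K) ⟩
      P * (P ^ L * P ^ K)                                  ≡⟨ *-assoc P (P ^ L) (P ^ K) ⟨
      P * P ^ L * P ^ K                                    ∎
      where
      open ≤-Reasoning
      w = negBinomialNumerator P d (suc L) K
      N = negBinomialNumerator P d L K

    expNumerator≤negBinomialNumerator : ∀ {x L} → x * P ≡ L * d → ∀ K →
      expNumerator x K * P ^ K ≤ K ! * negBinomialNumerator P d L K
    expNumerator≤negBinomialNumerator xP≡Ld zero    = ≤-refl
    expNumerator≤negBinomialNumerator {x} {L} xP≡Ld (suc K) = begin
      (suc K * E + x ^ suc K) * (P * P ^ K)
        ≡⟨ expand (suc K) E (x ^ suc K) P (P ^ K) ⟩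
      suc K * P * (E * P ^ K) + x ^ suc K * P ^ suc K
        ≡⟨ cong (suc K * P * (E * P ^ K) +_) (^-distribʳ-* x P (suc K)) ⟨
      suc K * P * (E * P ^ K) + (x * P) ^ suc K
        ≡⟨ cong (λ z → suc K * P * (E * P ^ K) + z ^ suc K) xP≡Ld ⟩
      suc K * P * (E * P ^ K) + (L * d) ^ suc K
        ≡⟨ cong (suc K * P * (E * P ^ K) +_) (^-distribʳ-* L d (suc K)) ⟩
      suc K * P * (E * P ^ K) + L ^ suc K * d ^ suc K
        ≤⟨ +-mono-≤ (*-monoʳ-≤ (suc K * P) (expNumerator≤negBinomialNumerator xP≡Ld K))
                    (*-monoˡ-≤ (d ^ suc K) (pow≤factorial*multichoose L (suc K))) ⟩
      suc K * P * (K ! * N) + suc K ! * multichoose L (suc K) * d ^ suc K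
        ≡⟨ collect (suc K) P (K !) N (multichoose L (suc K)) (d ^ suc K) ⟩
      suc K ! * (P * N + multichoose L (suc K) * d ^ suc K) ∎
      where
      open ≤-Reasoning
      E = expNumerator x K
      N = negBinomialNumerator P d L K
      expand : ∀ k s t p u → (k * s + t) * (p * u) ≡ k * p * (s * u) + t * (p * u)
      expand = solve-∀
      collect : ∀ k p f w b e → k * p * (f * w) + (k * f) * b * e ≡ (k * f) * (p * w + b * e)
      collect = solve-∀

    expNumerator≤ratioPower : ∀ {x L} → .{{NonZero P}} → x * P ≡ L * d → ∀ K →
      expNumerator x K * q ^ L ≤ K ! * P ^ L
    expNumerator≤ratioPower {x} {L} xP≡Ld K = *-cancelʳ-≤ _ _ (P ^ K) {{m^n≢0 P K}} (begin
      E * q ^ L * P ^ K      ≡⟨ xy∙z≈y∙xz E (q ^ L) (P ^ K) ⟩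
      q ^ L * (E * P ^ K)    ≤⟨ *-monoʳ-≤ (q ^ L) (expNumerator≤negBinomialNumerator xP≡Ld K) ⟩
      q ^ L * (K ! * N)      ≡⟨ x∙yz≈y∙xz (q ^ L) (K !) N ⟩
      K ! * (q ^ L * N)      ≤⟨ *-monoʳ-≤ (K !) (negBinomialNumerator-bound L K) ⟩
      K ! * (P ^ L * P ^ K)  ≡⟨ *-assoc (K !) (P ^ L) (P ^ K) ⟨
      K ! * P ^ L * P ^ K    ∎)
      where
      open ≤-Reasoning
      E = expNumerator x K
      N = negBinomialNumerator P d L K

  expNumerator≤pow : ∀ q d j n → 1 ≤ n → (q + d) ^ j ≤ q ^ j * n → ∀ K →
    expNumerator (j * d) K ≤ n ^ (q + d) * K !
  expNumerator≤pow q d zero n 1≤n _ K = expNumerator-zero≤ (q + d) 1≤n K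
  expNumerator≤pow q zero (suc j) n 1≤n _ K rewrite *-zeroʳ j = expNumerator-zero≤ (q + 0) 1≤n K
  expNumerator≤pow zero (suc d) (suc j) n _ P^j≤0 K = contradiction P^j≤0 (<⇒≱ (m^n>0 (suc d) (suc j)))
  expNumerator≤pow q@(suc _) d@(suc _) j@(suc _) n 1≤n P^j≤q^jn K =
    *-cancelʳ-≤ _ _ (q ^ L) {{m^n≢0 q L}} (begin
      expNumerator (j * d) K * q ^ L  ≤⟨ expNumerator≤ratioPower q d {L = L} (xy∙z≈xz∙y j d P) K ⟩
      K ! * P ^ L                     ≡⟨ cong (K ! *_) (^-*-assoc P j P) ⟨
      K ! * (P ^ j) ^ P               ≤⟨ *-monoʳ-≤ (K !) (^-monoˡ-≤ P P^j≤q^jn) ⟩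
      K ! * (q ^ j * n) ^ P           ≡⟨ cong (K ! *_) (^-distribʳ-* (q ^ j) n P) ⟩
      K ! * ((q ^ j) ^ P * n ^ P)     ≡⟨ cong (λ z → K ! * (z * n ^ P)) (^-*-assoc q j P) ⟩
      K ! * (q ^ L * n ^ P)           ≡⟨ x∙yz≈zx∙y (K !) (q ^ L) (n ^ P) ⟩
      n ^ P * K ! * q ^ L             ∎)
    where
    open ≤-Reasoning
    P = q + d
    L = j * P

module RationalPartialSums where

  open ExponentialSeries using (expNumerator)
  open import Data.Nat as ℕ using (zero; suc; pred; _!; _^_; NonZero)
  import Data.Nat.Properties as ℕ
  open import Data.Nat.Tactic.RingSolver using (solve-∀)
  open import Data.Integer as ℤ using (+_)
  import Data.Integer.Properties as ℤ
  import Data.Rational as ℚ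
  import Data.Rational.Properties as ℚ
  open import Data.Rational.Unnormalised as ℚᵘ using (mkℚᵘ; _≃_; *≡*; *≤*)
  import Data.Rational.Unnormalised.Properties as ℚᵘ
  open import Relation.Binary.PropositionalEquality

  s/f+x/kf≃[ks+x]/kf : ∀ s x k {f′ g′} → suc g′ ≡ k ℕ.* suc f′ →
    mkℚᵘ (+ s) f′ ℚᵘ.+ mkℚᵘ (+ x) g′ ≃ mkℚᵘ (+ (k ℕ.* s ℕ.+ x)) g′
  s/f+x/kf≃[ks+x]/kf s x k {f′} {g′} g≡kf = *≡* (begin
    (+ s ℤ.* + g ℤ.+ + x ℤ.* + f) ℤ.* + g
      ≡⟨ cong₂ (λ a b → (a ℤ.+ b) ℤ.* + g) (ℤ.pos-* s g) (ℤ.pos-* x f) ⟨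
    (+ (s ℕ.* g) ℤ.+ + (x ℕ.* f)) ℤ.* + g
      ≡⟨ cong (ℤ._* + g) (ℤ.pos-+ (s ℕ.* g) (x ℕ.* f)) ⟨
    + (s ℕ.* g ℕ.+ x ℕ.* f) ℤ.* + g
      ≡⟨ ℤ.pos-* (s ℕ.* g ℕ.+ x ℕ.* f) g ⟨
    + ((s ℕ.* g ℕ.+ x ℕ.* f) ℕ.* g)
      ≡⟨ cong (λ h → + ((s ℕ.* h ℕ.+ x ℕ.* f) ℕ.* g)) g≡kf ⟩
    + ((s ℕ.* (k ℕ.* f) ℕ.+ x ℕ.* f) ℕ.* g)
      ≡⟨ cong +_ (regroup s x k f g) ⟩
    + ((k ℕ.* s ℕ.+ x) ℕ.* (f ℕ.* g))
      ≡⟨ ℤ.pos-* (k ℕ.* s ℕ.+ x) (f ℕ.* g) ⟩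
    + (k ℕ.* s ℕ.+ x) ℤ.* + (f ℕ.* g) ∎)
    where
    open ≡-Reasoning
    f = suc f′
    g = suc g′
    regroup : ∀ s x k f g →
      (s ℕ.* (k ℕ.* f) ℕ.+ x ℕ.* f) ℕ.* g ≡ (k ℕ.* s ℕ.+ x) ℕ.* (f ℕ.* g)
    regroup = solve-∀

  fraction≤integer : ∀ {m n f′} → m ℕ.≤ n ℕ.* suc f′ → mkℚᵘ (+ m) f′ ℚᵘ.≤ mkℚᵘ (+ n) 0
  fraction≤integer {m} {n} {f′} m≤nf =
    *≤* (subst₂ ℤ._≤_ (sym (ℤ.*-identityʳ (+ m))) (ℤ.pos-* n (suc f′)) (ℤ.+≤+ m≤nf))

  toℚᵘ-/ : ∀ i n .{{_ : NonZero n}} → ℚ.toℚᵘ (i ℚ./ n) ≃ mkℚᵘ i (pred n)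
  toℚᵘ-/ i n = ℚᵘ.≃-trans (ℚ.toℚᵘ-cong (ℚ./-cong {i} refl (sym (ℕ.suc-pred n))))
                          (ℚ.toℚᵘ-fromℚᵘ (mkℚᵘ i (pred n)))

  expPartial≃ : ∀ a K → ℚ.toℚᵘ (expPartial a K) ≃ mkℚᵘ (+ expNumerator a K) (pred (K !))
  expPartial≃ a zero    = ℚᵘ.≃-refl
  expPartial≃ a (suc K) = begin-equality
    ℚ.toℚᵘ (expPartial a K ℚ.+ (+ a ^ suc K) ℚ./ suc K !)
      ≃⟨ ℚ.toℚᵘ-homo-+ (expPartial a K) _ ⟩
    ℚ.toℚᵘ (expPartial a K) ℚᵘ.+ ℚ.toℚᵘ ((+ a ^ suc K) ℚ./ suc K !)
      ≃⟨ ℚᵘ.+-cong (expPartial≃ a K) (toℚᵘ-/ (+ a ^ suc K) (suc K !)) ⟩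
    mkℚᵘ (+ expNumerator a K) (pred (K !)) ℚᵘ.+ mkℚᵘ (+ a ^ suc K) (pred (suc K !))
      ≃⟨ s/f+x/kf≃[ks+x]/kf (expNumerator a K) (a ^ suc K) (suc K) denominators ⟩
    mkℚᵘ (+ expNumerator a (suc K)) (pred (suc K !)) ∎
    where
    open ℚᵘ.≤-Reasoning
    instance
      _ = K ℕ.!≢0
      _ = suc K ℕ.!≢0
    denominators : suc (pred (suc K !)) ≡ suc K ℕ.* suc (pred (K !))
    denominators = trans (ℕ.suc-pred (suc K !)) (cong (suc K ℕ.*_) (sym (ℕ.suc-pred (K !))))

  expNumerator≤⇒ExpLe : ∀ a N → (∀ K → expNumerator a K ℕ.≤ N ℕ.* K !) → ExpLe a N
  expNumerator≤⇒ExpLe a N bound K = ℚ.toℚᵘ-cancel-≤ (begin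
    ℚ.toℚᵘ (expPartial a K)                 ≃⟨ expPartial≃ a K ⟩
    mkℚᵘ (+ expNumerator a K) (pred (K !))  ≤⟨ fraction≤integer bound′ ⟩
    mkℚᵘ (+ N) 0                            ≃⟨ ℚ.toℚᵘ-fromℚᵘ (mkℚᵘ (+ N) 0) ⟨
    ℚ.toℚᵘ ((+ N) ℚ./ 1)                    ∎)
    where
    open ℚᵘ.≤-Reasoning
    instance _ = K ℕ.!≢0
    bound′ : expNumerator a K ℕ.≤ N ℕ.* suc (pred (K !))
    bound′ = subst (λ f → expNumerator a K ℕ.≤ N ℕ.* f) (sym (ℕ.suc-pred (K !))) (bound K)

module Subsets where

  open import Data.Nat
  open import Data.Nat.Properties using (≤-trans; ≰⇒≥; +-suc; _≤?_)
  open import Data.Fin using (Fin; zero; suc)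
  open import Data.Fin.Properties using (suc-injective)
  open import Data.Fin.Subset using (Subset; _∈_; _∉_; _⊆_; ∣_∣; inside; outside; _─_; ⁅_⁆)
  open import Data.Fin.Subset.Properties using (drop-∷-⊆; x∈⁅x⁆)
  open import Data.Vec using ([]; _∷_; here; there)
  open import Data.Sum using (_⊎_; inj₁; inj₂)
  open import Level using (0ℓ)
  open import Relation.Nullary using (¬_; yes; no; contradiction)
  open import Relation.Unary using (Pred; Decidable)
  open import Relation.Binary.PropositionalEquality

  largestSubset : ∀ {n} {P : Pred (Subset n) 0ℓ} → Decidable P →
    (∀ W → ¬ P W) ⊎ ∃[ W ] (P W × ∀ W′ → P W′ → ∣ W′ ∣ ≤ ∣ W ∣)
  largestSubset {zero} P? with P? []
  ... | yes p = inj₂ ([] , p , λ { [] _ → z≤n })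
  ... | no ¬p = inj₁ λ { [] → ¬p }
  largestSubset {suc n} P?
    with largestSubset (λ W → P? (outside ∷ W)) | largestSubset (λ W → P? (inside ∷ W))
  ... | inj₁ ¬out | inj₁ ¬in = inj₁ λ { (outside ∷ W) → ¬out W ; (inside ∷ W) → ¬in W }
  ... | inj₂ (V , p , maxV) | inj₁ ¬in = inj₂ (outside ∷ V , p , λ
    { (outside ∷ W′) p′ → maxV W′ p′
    ; (inside  ∷ W′) p′ → contradiction p′ (¬in W′) })
  ... | inj₁ ¬out | inj₂ (W , q , maxW) = inj₂ (inside ∷ W , q , λ
    { (outside ∷ W′) p′ → contradiction p′ (¬out W′)
    ; (inside  ∷ W′) p′ → s≤s (maxW W′ p′) })
  ... | inj₂ (V , p , maxV) | inj₂ (W , q , maxW) with ∣ V ∣ ≤? suc ∣ W ∣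
  ...   | yes V≤W = inj₂ (inside ∷ W , q , λ
    { (outside ∷ W′) p′ → ≤-trans (maxV W′ p′) V≤W
    ; (inside  ∷ W′) p′ → s≤s (maxW W′ p′) })
  ...   | no  V≰W = inj₂ (outside ∷ V , p , λ
    { (outside ∷ W′) p′ → maxV W′ p′
    ; (inside  ∷ W′) p′ → ≤-trans (s≤s (maxW W′ p′)) (≰⇒≥ V≰W) })

  ∣p─q∣+∣q∣≡∣p∣ : ∀ {n} {p q : Subset n} → q ⊆ p → ∣ p ─ q ∣ + ∣ q ∣ ≡ ∣ p ∣
  ∣p─q∣+∣q∣≡∣p∣ {p = []}          {[]}          _   = refl
  ∣p─q∣+∣q∣≡∣p∣ {p = inside  ∷ p} {inside  ∷ q} q⊆p =
    trans (+-suc _ _) (cong suc (∣p─q∣+∣q∣≡∣p∣ (drop-∷-⊆ q⊆p)))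
  ∣p─q∣+∣q∣≡∣p∣ {p = inside  ∷ p} {outside ∷ q} q⊆p = cong suc (∣p─q∣+∣q∣≡∣p∣ (drop-∷-⊆ q⊆p))
  ∣p─q∣+∣q∣≡∣p∣ {p = outside ∷ p} {inside  ∷ q} q⊆p = contradiction (q⊆p here) λ ()
  ∣p─q∣+∣q∣≡∣p∣ {p = outside ∷ p} {outside ∷ q} q⊆p = ∣p─q∣+∣q∣≡∣p∣ (drop-∷-⊆ q⊆p)

  x∈p─q⇒x∉q : ∀ {n} {p q : Subset n} {x} → x ∈ p ─ q → x ∉ q
  x∈p─q⇒x∉q {p = _ ∷ p} {outside ∷ q} (there x∈p─q) (there x∈q) = x∈p─q⇒x∉q x∈p─q x∈q
  x∈p─q⇒x∉q {p = _ ∷ p} {inside  ∷ q} (there x∈p─q) (there x∈q) = x∈p─q⇒x∉q x∈p─q x∈q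

  x∉p─⁅x⁆ : ∀ {n} {p : Subset n} {x} → x ∉ p ─ ⁅ x ⁆
  x∉p─⁅x⁆ {x = x} x∈p─x = x∈p─q⇒x∉q x∈p─x (x∈⁅x⁆ x)

  embed : ∀ {n} (U : Subset n) → Fin ∣ U ∣ → Fin n
  embed (inside  ∷ U) zero    = zero
  embed (inside  ∷ U) (suc i) = suc (embed U i)
  embed (outside ∷ U) i       = suc (embed U i)

  embedSubset : ∀ {n} (U : Subset n) → Subset ∣ U ∣ → Subset n
  embedSubset []            []      = []
  embedSubset (inside  ∷ U) (x ∷ W) = x ∷ embedSubset U W
  embedSubset (outside ∷ U) W       = outside ∷ embedSubset U W

  embed-injective : ∀ {n} (U : Subset n) {i j} → embed U i ≡ embed U j → i ≡ j
  embed-injective (inside  ∷ U) {zero}  {zero}  _  = refl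
  embed-injective (inside  ∷ U) {suc i} {suc j} eq = cong suc (embed-injective U (suc-injective eq))
  embed-injective (outside ∷ U)                 eq = embed-injective U (suc-injective eq)

  ∣embedSubset∣≡∣W∣ : ∀ {n} (U : Subset n) W → ∣ embedSubset U W ∣ ≡ ∣ W ∣
  ∣embedSubset∣≡∣W∣ []            []            = refl
  ∣embedSubset∣≡∣W∣ (inside  ∷ U) (inside  ∷ W) = cong suc (∣embedSubset∣≡∣W∣ U W)
  ∣embedSubset∣≡∣W∣ (inside  ∷ U) (outside ∷ W) = ∣embedSubset∣≡∣W∣ U W
  ∣embedSubset∣≡∣W∣ (outside ∷ U) W             = ∣embedSubset∣≡∣W∣ U W

  embedSubset⊆U : ∀ {n} (U : Subset n) W → embedSubset U W ⊆ U
  embedSubset⊆U (inside  ∷ U) (_ ∷ W) here      = here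
  embedSubset⊆U (inside  ∷ U) (_ ∷ W) (there x) = there (embedSubset⊆U U W x)
  embedSubset⊆U (outside ∷ U) W       (there x) = there (embedSubset⊆U U W x)

  embedSubset⁻ : ∀ {n} (U : Subset n) W {u} → u ∈ embedSubset U W → ∃[ i ] (i ∈ W × embed U i ≡ u)
  embedSubset⁻ (inside  ∷ U) (_ ∷ W) here = zero , here , refl
  embedSubset⁻ (inside  ∷ U) (_ ∷ W) (there u∈) with embedSubset⁻ U W u∈
  ... | i , i∈W , refl = suc i , there i∈W , refl
  embedSubset⁻ (outside ∷ U) W (there u∈) with embedSubset⁻ U W u∈
  ... | i , i∈W , refl = i , i∈W , refl

module GreedyColouring where

  open ExponentialSeries using (expNumerator; expNumerator-monoˡ-≤; expNumerator≤pow)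
  open RationalPartialSums using (expNumerator≤⇒ExpLe)
  open Subsets using (largestSubset; ∣p─q∣+∣q∣≡∣p∣)
  open import Data.Nat
  open import Data.Nat.Properties
  open import Data.Nat.Induction using (<-wellFounded)
  open import Induction.WellFounded using (Acc; acc)
  open import Algebra.Properties.CommutativeSemigroup *-commutativeSemigroup
    using (x∙yz≈y∙xz; x∙yz≈yx∙z; x∙yz≈zx∙y; xy∙z≈y∙xz; xy∙z≈x∙zy)
  open import Data.Bool using (true; false)
  import Data.Bool.Properties as Bool
  open import Data.Fin using (Fin; zero; suc)
  open import Data.Fin.Properties using (all?)
  import Data.Fin.Properties as Fin
  open import Data.Fin.Subset using (Subset; _∈_; _⊆_; ∣_∣; _─_; ⁅_⁆; ⊥; ⊤; Nonempty)
  open import Data.Fin.Subset.Properties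
  open import Data.Product using (Σ; proj₁; proj₂)
  open import Data.Sum using (inj₁; inj₂)
  open import Function using (_∘_)
  open import Relation.Nullary using (yes; no; contradiction)
  open import Relation.Nullary.Decidable using (_×-dec_; _→-dec_)
  open import Relation.Unary using (Decidable)
  open import Relation.Binary.PropositionalEquality

  -- a record rather than a * d ≤ c * b itself, so that a, b, c and d can be inferred
  record _/_≤ᶠ_/_ (a b c d : ℕ) : Set where
    constructor cross
    field a*d≤c*b : a * d ≤ c * b

  ≤ᶠ-trans : ∀ {a b c d e f} → 1 ≤ d → a / b ≤ᶠ c / d → c / d ≤ᶠ e / f → a / b ≤ᶠ e / f
  ≤ᶠ-trans {a} {b} {c} {d@(suc _)} {e} {f} _ (cross ad≤cb) (cross cf≤ed) = cross (*-cancelˡ-≤ d (begin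
    d * (a * f)  ≡⟨ x∙yz≈yx∙z d a f ⟩
    a * d * f    ≤⟨ *-monoˡ-≤ f ad≤cb ⟩
    c * b * f    ≡⟨ xy∙z≈y∙xz c b f ⟩
    b * (c * f)  ≤⟨ *-monoʳ-≤ b cf≤ed ⟩
    b * (e * d)  ≡⟨ x∙yz≈zx∙y b e d ⟩
    d * b * e    ≡⟨ xy∙z≈x∙zy d b e ⟩
    d * (e * b)  ∎))
    where open ≤-Reasoning

  removal-shrinks : ∀ {q d m s m′} → m′ + s ≡ m → d / (q + d) ≤ᶠ s / m → (q + d) * m′ ≤ q * m
  removal-shrinks {q} {d} {m} {s} {m′} m′+s≡m (cross dm≤s[q+d]) = +-cancelʳ-≤ (d * m) _ _ (begin
    (q + d) * m′ + d * m        ≤⟨ +-monoʳ-≤ ((q + d) * m′) dm≤s[q+d] ⟩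
    (q + d) * m′ + s * (q + d)  ≡⟨ cong ((q + d) * m′ +_) (*-comm s (q + d)) ⟩
    (q + d) * m′ + (q + d) * s  ≡⟨ *-distribˡ-+ (q + d) m′ s ⟨
    (q + d) * (m′ + s)          ≡⟨ cong ((q + d) *_) m′+s≡m ⟩
    (q + d) * m                 ≡⟨ *-distribʳ-+ m q d ⟩
    q * m + d * m               ∎)
    where open ≤-Reasoning

  module _ {n} (G : Graph n) where

    independent? : Decidable (Independent G)
    independent? W = all? λ i → all? λ j → (i ∈? W) →-dec ((j ∈? W) →-dec (adj G i j Bool.≟ false))

    independent⇒¬adj : ∀ {W i j} → Independent G W → i ∈ W → j ∈ W → adj G i j ≢ true
    independent⇒¬adj indW i∈W j∈W aij with () ← trans (sym aij) (indW _ _ i∈W j∈W)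

    singleton-independent : ∀ i → Independent G ⁅ i ⁆
    singleton-independent i j k j∈ k∈ rewrite x∈⁅y⁆⇒x≡y i j∈ | x∈⁅y⁆⇒x≡y i k∈ = irrefl G i

    MaximumIndependentIn : Subset n → Subset n → Set
    MaximumIndependentIn U W = W ⊆ U × Independent G W × InducedIndepAtMost G U ∣ W ∣

    maximumIndependentIn : ∀ U → ∃[ W ] MaximumIndependentIn U W
    maximumIndependentIn U with largestSubset (λ W → (W ⊆? U) ×-dec independent? W)
    ... | inj₁ none = contradiction ((λ {x} → ⊥⊆ {x = x}) , λ i _ i∈⊥ _ → contradiction i∈⊥ ∉⊥) (none ⊥)
    ... | inj₂ (W , (W⊆U , indW) , max) =
      W , W⊆U , indW , λ W′ W′⊆U indW′ → max W′ (W′⊆U , indW′)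

    maximumIndependent-nonempty : ∀ {U W i} → MaximumIndependentIn U W → i ∈ U → 1 ≤ ∣ W ∣
    maximumIndependent-nonempty {i = i} (_ , _ , max) i∈U = subst (_≤ _) (∣⁅x⁆∣≡1 i)
      (max ⁅ i ⁆ (λ j∈ → subst (_∈ _) (sym (x∈⁅y⁆⇒x≡y i j∈)) i∈U) (singleton-independent i))

    ColouringOn : Subset n → ℕ → Set
    ColouringOn U k =
      Σ (Fin n → Fin k) λ f → ∀ {i j} → i ∈ U → j ∈ U → adj G i j ≡ true → f i ≢ f j

    extendColouring : ∀ {U W k} → Independent G W → ColouringOn (U ─ W) k → ColouringOn U (suc k)
    extendColouring {U} {W} {k} indW (f , f-proper) = colour , colour-proper
      where
      colour : Fin n → Fin (suc k)
      colour i with i ∈? W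
      ... | yes _ = zero
      ... | no  _ = suc (f i)
      colour-proper : ∀ {i j} → i ∈ U → j ∈ U → adj G i j ≡ true → colour i ≢ colour j
      colour-proper {i} {j} i∈U j∈U aij with i ∈? W | j ∈? W
      ... | yes i∈W | yes j∈W = λ _ → independent⇒¬adj indW i∈W j∈W aij
      ... | yes _   | no  _   = λ ()
      ... | no  _   | yes _   = λ ()
      ... | no  i∉W | no  j∉W =
        f-proper (x∈p∧x∉q⇒x∈p─q i∈U i∉W) (x∈p∧x∉q⇒x∈p─q j∈U j∉W) aij ∘ Fin.suc-injective

    record Round : Set where
      constructor round
      field
        {U W}    : Subset n
        maximum  : MaximumIndependentIn U W
        nonempty : 1 ≤ ∣ W ∣

      U-nonempty : 1 ≤ ∣ U ∣
      U-nonempty = ≤-trans nonempty (p⊆q⇒∣p∣≤∣q∣ (proj₁ maximum))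

    RatioBelow : ℕ → ℕ → Round → Set
    RatioBelow d P r = d / P ≤ᶠ ∣ Round.W r ∣ / ∣ Round.U r ∣

    sparser : (r r′ : Round) →
      ∃[ s ] (∀ {d P} → RatioBelow d P s → RatioBelow d P r × RatioBelow d P r′)
    sparser r r′ with ∣ Round.W r′ ∣ * ∣ Round.U r ∣ ≤? ∣ Round.W r ∣ * ∣ Round.U r′ ∣
    ... | yes r′≤r = r′ , λ below′ → ≤ᶠ-trans (Round.U-nonempty r′) below′ (cross r′≤r) , below′
    ... | no  r′≰r = r  , λ below → below , ≤ᶠ-trans (Round.U-nonempty r) below (cross (≰⇒≥ r′≰r))

    record GreedyColouring (U : Subset n) : Set where
      field
        steps     : ℕ
        colouring : ColouringOn U (suc steps)
        sparsest  : Round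
        shrinking : ∀ q d → RatioBelow d (q + d) sparsest → (q + d) ^ steps ≤ q ^ steps * ∣ U ∣

    lastClass : ∀ {U W} → MaximumIndependentIn U W → 1 ≤ ∣ W ∣ → U ⊆ W → GreedyColouring U
    lastClass maxW@(_ , indW , _) 1≤W U⊆W = record
      { steps     = 0
      ; colouring = (λ _ → zero) , λ i∈U j∈U aij _ →
                      independent⇒¬adj indW (U⊆W i∈U) (U⊆W j∈U) aij
      ; sparsest  = r
      ; shrinking = λ _ _ _ → ≤-trans (Round.U-nonempty r) (≤-reflexive (sym (*-identityˡ _)))
      }
      where r = round maxW 1≤W

    addClass : ∀ {U W} → MaximumIndependentIn U W → 1 ≤ ∣ W ∣ →
      GreedyColouring (U ─ W) → GreedyColouring U
    addClass {U} {W} maxW@(W⊆U , indW , _) 1≤W rest = record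
      { steps     = suc steps
      ; colouring = extendColouring indW colouring
      ; sparsest  = proj₁ best
      ; shrinking = λ q d below → let (belowW , below₀) = proj₂ best below in begin
          (q + d) * (q + d) ^ steps          ≤⟨ *-monoʳ-≤ (q + d) (shrinking q d below₀) ⟩
          (q + d) * (q ^ steps * ∣ U ─ W ∣)  ≡⟨ x∙yz≈y∙xz (q + d) (q ^ steps) ∣ U ─ W ∣ ⟩
          q ^ steps * ((q + d) * ∣ U ─ W ∣)  ≤⟨ *-monoʳ-≤ (q ^ steps) (removal-shrinks ∣U─W∣+∣W∣≡∣U∣ belowW) ⟩
          q ^ steps * (q * ∣ U ∣)            ≡⟨ x∙yz≈yx∙z (q ^ steps) q ∣ U ∣ ⟩
          q * q ^ steps * ∣ U ∣              ∎
      }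
      where
      open GreedyColouring rest
      open ≤-Reasoning
      best = sparser (round maxW 1≤W) sparsest
      ∣U─W∣+∣W∣≡∣U∣ = ∣p─q∣+∣q∣≡∣p∣ W⊆U

    greedyColouring : ∀ U → Nonempty U → GreedyColouring U
    greedyColouring U = go U (<-wellFounded ∣ U ∣)
      where
      go : ∀ U → Acc _<_ ∣ U ∣ → Nonempty U → GreedyColouring U
      go U (acc rs) (i , i∈U) with maximumIndependentIn U
      ... | W , maxW@(W⊆U , _)
        with 1≤W ← maximumIndependent-nonempty maxW i∈U
        with nonempty? (U ─ W)
      ...   | yes U─W≢∅ = addClass maxW 1≤W (go (U ─ W) (rs smaller) U─W≢∅)
        where
        smaller : ∣ U ─ W ∣ < ∣ U ∣
        smaller = subst (∣ U ─ W ∣ <_) (∣p─q∣+∣q∣≡∣p∣ W⊆U) (m<m+n ∣ U ─ W ∣ 1≤W)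
      ...   | no  U─W≡∅ = lastClass maxW 1≤W U⊆W
        where
        U⊆W : U ⊆ W
        U⊆W {j} j∈U with j ∈? W
        ... | yes j∈W = j∈W
        ... | no  j∉W = contradiction (j , x∈p∧x∉q⇒x∈p─q j∈U j∉W) U─W≡∅

  chromatic-bound : ∀ {n} (G : Graph n) → 1 ≤ n → ∀ {a c} →
    IsIndependenceNumber G a → IsChromaticNumber G c →
    ∃[ d ] (1 ≤ d × d ≤ a × ∀ p → IsPsi G d p → LnBound n c d p)
  chromatic-bound {n@(suc _)} G 1≤n {c = c} (_ , α-max) (_ , χ-min) =
    d , Round.nonempty sparsest , α-max d (W₀ , proj₁ (proj₂ maximum₀) , refl) , ln-bound
    where
    open GreedyColouring (greedyColouring G ⊤ (zero , ∈⊤))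
    open Round sparsest renaming (U to U₀; W to W₀; maximum to maximum₀)
    d = ∣ W₀ ∣
    c∸1≤steps : c ∸ 1 ≤ steps
    c∸1≤steps = ∸-monoˡ-≤ 1 (χ-min (suc steps) (proj₁ colouring , λ _ _ → proj₂ colouring ∈⊤ ∈⊤))
    ln-bound : ∀ p → IsPsi G d p → LnBound n c d p
    ln-bound p (_ , ψ-max) = expNumerator≤⇒ExpLe _ (n ^ p) λ K → begin
      expNumerator ((c ∸ 1) * d) K  ≤⟨ expNumerator-monoˡ-≤ (*-monoˡ-≤ d c∸1≤steps) K ⟩
      expNumerator (steps * d) K    ≤⟨ expNumerator≤pow q d steps n 1≤n decay K ⟩
      n ^ (q + d) * K !             ≡⟨ cong (λ P → n ^ P * K !) q+d≡p ⟩
      n ^ p * K !                   ∎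
      where
      open ≤-Reasoning
      U₀≤p : ∣ U₀ ∣ ≤ p
      U₀≤p = ψ-max ∣ U₀ ∣ (U₀ , proj₂ (proj₂ maximum₀) , refl)
      q = p ∸ d
      q+d≡p : q + d ≡ p
      q+d≡p = m∸n+n≡m (≤-trans (p⊆q⇒∣p∣≤∣q∣ (proj₁ maximum₀)) U₀≤p)
      decay : (q + d) ^ steps ≤ q ^ steps * n
      decay = subst (λ m → (q + d) ^ steps ≤ q ^ steps * m) (∣⊤∣≡n n)
        (shrinking q d (cross (*-monoʳ-≤ d (subst (∣ U₀ ∣ ≤_) (sym q+d≡p) U₀≤p))))

module LinearAlgebra where

  open Subsets
  open import Data.Nat as ℕ using (ℕ; zero; suc)
  import Data.Nat.Properties as ℕ
  open import Data.Rational as ℚ using (ℚ; 0ℚ; 1ℚ; _+_; _*_; -_; _-_)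
  open import Data.Rational.Properties as ℚ using (_≟_; +-*-commutativeRing)
  open import Data.Rational.Solver using (module +-*-Solver)
  open import Algebra.Bundles using (CommutativeRing)
  open import Algebra.Properties.Semiring.Sum (CommutativeRing.semiring +-*-commutativeRing)
    using (sum; sum-cong-≗; ∑-distrib-+; *-distribˡ-sum; sum-replicate-zero)
  open import Data.Fin using (Fin; zero; suc)
  import Data.Fin.Properties as Fin
  open import Data.Fin.Properties using (any?)
  open import Data.Fin.Subset using (Subset; _∈_; _∉_; _⊆_; ∣_∣; _─_; ⁅_⁆; ⊥; inside; outside)
  open import Data.Vec using ([]; _∷_)
  open import Data.Fin.Subset.Properties
  open import Data.Vec.Functional using (updateAt)
  open import Data.Vec.Functional.Properties using (updateAt-updates; updateAt-minimal)
  open import Data.Sum as Sum using (_⊎_; inj₁; inj₂)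
  open import Function using (_∘_; case_of_)
  open import Function.Bundles using (_⇔_; mk⇔)
  open import Relation.Nullary using (yes; no; contradiction)
  import Relation.Nullary.Decidable as Dec
  open import Relation.Nullary.Decidable using (_×-dec_; ¬?)
  open import Relation.Unary using (Decidable)
  open import Relation.Binary.PropositionalEquality

  open +-*-Solver

  sumℚ≡sum : ∀ {n} (f : Fin n → ℚ) → sumℚ f ≡ sum f
  sumℚ≡sum {zero}  f = refl
  sumℚ≡sum {suc n} f = cong (f zero +_) (sumℚ≡sum (f ∘ suc))

  sum-zero : ∀ {n} {f : Fin n → ℚ} → (∀ i → f i ≡ 0ℚ) → sum f ≡ 0ℚ
  sum-zero {n} f≗0 = trans (sum-cong-≗ f≗0) (sum-replicate-zero n)

  ∑-linear : ∀ {n} a b (f g : Fin n → ℚ) → sum (λ i → a * f i + b * g i) ≡ a * sum f + b * sum g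
  ∑-linear a b f g = trans (∑-distrib-+ (λ i → a * f i) (λ i → b * g i))
                           (sym (cong₂ _+_ (*-distribˡ-sum a f) (*-distribˡ-sum b g)))

  ∑-updateAt : ∀ {n} (c x : Fin n → ℚ) i β →
    sum (λ l → updateAt c i (_+ β) l * x l) ≡ sum (λ l → c l * x l) + β * x i
  ∑-updateAt c x zero    β = regroup (c zero) (x zero) (sum (λ l → c (suc l) * x (suc l))) β
    where
    regroup : ∀ c₀ x₀ s β → (c₀ + β) * x₀ + s ≡ c₀ * x₀ + s + β * x₀
    regroup = solve 4 (λ c₀ x₀ s β → (c₀ :+ β) :* x₀ :+ s := c₀ :* x₀ :+ s :+ β :* x₀) refl
  ∑-updateAt c x (suc i) β = trans (cong (c zero * x zero +_) (∑-updateAt (c ∘ suc) (x ∘ suc) i β))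
    (sym (ℚ.+-assoc (c zero * x zero) _ _))

  sum-embed : ∀ {n} (U : Subset n) (f : Fin n → ℚ) → (∀ u → u ∉ U → f u ≡ 0ℚ) →
    sum f ≡ sum (f ∘ embed U)
  sum-embed []            f f-supp = refl
  sum-embed (inside  ∷ U) f f-supp =
    cong (f zero +_) (sum-embed U (f ∘ suc) (λ u u∉U → f-supp (suc u) (u∉U ∘ drop-there)))
  sum-embed (outside ∷ U) f f-supp = begin
    f zero + sum (f ∘ suc)  ≡⟨ cong (_+ sum (f ∘ suc)) (f-supp zero λ ()) ⟩
    0ℚ + sum (f ∘ suc)      ≡⟨ ℚ.+-identityˡ _ ⟩
    sum (f ∘ suc)           ≡⟨ sum-embed U (f ∘ suc) (λ u u∉U → f-supp (suc u) (u∉U ∘ drop-there)) ⟩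
    sum (f ∘ embed (outside ∷ U)) ∎
    where open ≡-Reasoning

  *-zero-cancelˡ : ∀ {a b} → a ≢ 0ℚ → a * b ≡ 0ℚ → b ≡ 0ℚ
  *-zero-cancelˡ {a} {b} a≢0 ab≡0 = begin
    b                  ≡⟨ ℚ.*-identityˡ b ⟨
    1ℚ * b             ≡⟨ cong (_* b) (ℚ.*-inverseˡ a) ⟨
    ℚ.1/ a * a * b     ≡⟨ ℚ.*-assoc (ℚ.1/ a) a b ⟩
    ℚ.1/ a * (a * b)   ≡⟨ cong (ℚ.1/ a *_) ab≡0 ⟩
    ℚ.1/ a * 0ℚ        ≡⟨ ℚ.*-zeroʳ (ℚ.1/ a) ⟩
    0ℚ                 ∎
    where
    open ≡-Reasoning
    instance _ = ℚ.≢-nonZero a≢0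

  *-zero-cancelʳ : ∀ {a b} → b ≢ 0ℚ → a * b ≡ 0ℚ → a ≡ 0ℚ
  *-zero-cancelʳ {a} {b} b≢0 ab≡0 = *-zero-cancelˡ b≢0 (trans (ℚ.*-comm b a) ab≡0)

  SupportedOn : ∀ {k} → (Fin k → ℚ) → Subset k → Set
  SupportedOn c S = ∀ i → i ∉ S → c i ≡ 0ℚ

  module _ {k m : ℕ} where

    Annihilates : (Fin k → ℚ) → (Fin k → Fin m → ℚ) → Set
    Annihilates c v = ∀ j → sum (λ i → c i * v i j) ≡ 0ℚ

    LinearlyIndependent : (Fin k → Fin m → ℚ) → Subset k → Set
    LinearlyIndependent v S = ∀ c → SupportedOn c S → Annihilates c v → ∀ i → c i ≡ 0ℚ

    LinearlyDependent : (Fin k → Fin m → ℚ) → Subset k → Set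
    LinearlyDependent v S = ∃[ c ] (SupportedOn c S × Annihilates c v × ∃[ i ] c i ≢ 0ℚ)

  SupportedOn-mono : ∀ {k} {S T : Subset k} {c} → S ⊆ T → SupportedOn c S → SupportedOn c T
  SupportedOn-mono S⊆T c-supp i i∉T = c-supp i (i∉T ∘ S⊆T)

  SupportedOn-combination : ∀ {k} {S : Subset k} {f g} a b → SupportedOn f S → SupportedOn g S →
    SupportedOn (λ i → a * f i + b * g i) S
  SupportedOn-combination a b f-supp g-supp i i∉S = begin
    a * _ + b * _     ≡⟨ cong₂ (λ x y → a * x + b * y) (f-supp i i∉S) (g-supp i i∉S) ⟩
    a * 0ℚ + b * 0ℚ   ≡⟨ cong₂ _+_ (ℚ.*-zeroʳ a) (ℚ.*-zeroʳ b) ⟩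
    0ℚ                ∎
    where open ≡-Reasoning

  Annihilates-combination : ∀ {k m} {v : Fin k → Fin m → ℚ} {f g} a b →
    Annihilates f v → Annihilates g v → Annihilates (λ i → a * f i + b * g i) v
  Annihilates-combination {v = v} {f} {g} a b f-ann g-ann j = begin
    sum (λ i → (a * f i + b * g i) * v i j)
      ≡⟨ sum-cong-≗ (λ i → distrib a b (f i) (g i) (v i j)) ⟩
    sum (λ i → a * (f i * v i j) + b * (g i * v i j))
      ≡⟨ ∑-linear a b (λ i → f i * v i j) (λ i → g i * v i j) ⟩
    a * sum (λ i → f i * v i j) + b * sum (λ i → g i * v i j)
      ≡⟨ cong₂ (λ x y → a * x + b * y) (f-ann j) (g-ann j) ⟩
    a * 0ℚ + b * 0ℚ
      ≡⟨ cong₂ _+_ (ℚ.*-zeroʳ a) (ℚ.*-zeroʳ b) ⟩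
    0ℚ ∎
    where
    open ≡-Reasoning
    distrib : ∀ a b f g x → (a * f + b * g) * x ≡ a * (f * x) + b * (g * x)
    distrib = solve 5 (λ a b f g x → (a :* f :+ b :* g) :* x := a :* (f :* x) :+ b :* (g :* x)) refl

  LinearlyIndependent-cong : ∀ {k m} {v w : Fin k → Fin m → ℚ} {S} → (∀ i j → v i j ≡ w i j) →
    LinearlyIndependent v S → LinearlyIndependent w S
  LinearlyIndependent-cong v≡w ind c c-supp c-ann =
    ind c c-supp λ j → trans (sum-cong-≗ λ i → cong (c i *_) (v≡w i j)) (c-ann j)

  module Pivot {k m} (v : Fin k → Fin (suc m) → ℚ) {S : Subset k} {i₀}
               (i₀∈S : i₀ ∈ S) (a≢0 : v i₀ zero ≢ 0ℚ) where

    a : ℚ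
    a = v i₀ zero

    S′ : Subset k
    S′ = S ─ ⁅ i₀ ⁆

    -- fraction-free elimination of column zero against the pivot row i₀
    w : Fin k → Fin m → ℚ
    w l j = a * v l (suc j) - v l zero * v i₀ (suc j)

    w-combination : ∀ (c : Fin k → ℚ) j → sum (λ l → c l * w l j) ≡
      a * sum (λ l → c l * v l (suc j)) + (- v i₀ (suc j)) * sum (λ l → c l * v l zero)
    w-combination c j = trans
      (sum-cong-≗ λ l → expand a (v i₀ (suc j)) (c l) (v l (suc j)) (v l zero))
      (∑-linear a (- v i₀ (suc j)) (λ l → c l * v l (suc j)) (λ l → c l * v l zero))
      where
      expand : ∀ a b c x y → c * (a * x - y * b) ≡ a * (c * x) + (- b) * (c * y)
      expand = solve 5 (λ a b c x y → c :* (a :* x :- y :* b) := a :* (c :* x) :+ (:- b) :* (c :* y)) refl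

    fromIndependent : LinearlyIndependent w S′ → LinearlyIndependent v S
    fromIndependent w-independent c c-supp c-ann = c≡0
      where
      c′ = updateAt c i₀ (_+ (- c i₀))
      c′-sum : ∀ x → sum (λ l → c′ l * x l) ≡ sum (λ l → c l * x l) + (- c i₀) * x i₀
      c′-sum x = ∑-updateAt c x i₀ (- c i₀)
      c′-off : ∀ {l} → l ≢ i₀ → c′ l ≡ c l
      c′-off l≢i₀ = updateAt-minimal _ i₀ c l≢i₀
      c′-supp : SupportedOn c′ S′
      c′-supp l l∉S′ with l Fin.≟ i₀
      ... | yes refl  = trans (updateAt-updates i₀ c) (ℚ.+-inverseʳ (c i₀))
      ... | no  l≢i₀ = trans (c′-off l≢i₀) (c-supp l λ l∈S → l∉S′ (x∈p∧x≢y⇒x∈p-y l∈S l≢i₀))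
      c′-ann : Annihilates c′ w
      c′-ann j = begin
        sum (λ l → c′ l * w l j)
          ≡⟨ w-combination c′ j ⟩
        a * sum (λ l → c′ l * v l (suc j)) + (- b) * sum (λ l → c′ l * v l zero)
          ≡⟨ cong₂ (λ s t → a * s + (- b) * t) (c′-sum _) (c′-sum _) ⟩
        a * (sum (λ l → c l * v l (suc j)) + (- c i₀) * b) +
          (- b) * (sum (λ l → c l * v l zero) + (- c i₀) * a)
          ≡⟨ cong₂ (λ s t → a * (s + (- c i₀) * b) + (- b) * (t + (- c i₀) * a)) (c-ann (suc j)) (c-ann zero) ⟩
        a * (0ℚ + (- c i₀) * b) + (- b) * (0ℚ + (- c i₀) * a)
          ≡⟨ cancel a b (c i₀) ⟩
        0ℚ ∎
        where
        open ≡-Reasoning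
        b = v i₀ (suc j)
        cancel : ∀ a b x → a * (0ℚ + (- x) * b) + (- b) * (0ℚ + (- x) * a) ≡ 0ℚ
        cancel = solve 3 (λ a b x →
          a :* (con 0ℚ :+ (:- x) :* b) :+ (:- b) :* (con 0ℚ :+ (:- x) :* a) := con 0ℚ) refl
      c′≡0 : ∀ l → c′ l ≡ 0ℚ
      c′≡0 = w-independent c′ c′-supp c′-ann
      c-i₀ : c i₀ ≡ 0ℚ
      c-i₀ = ℚ.neg-injective (*-zero-cancelʳ a≢0 (begin
        (- c i₀) * a                                 ≡⟨ ℚ.+-identityˡ _ ⟨
        0ℚ + (- c i₀) * a                            ≡⟨ cong (_+ (- c i₀) * a) (c-ann zero) ⟨
        sum (λ l → c l * v l zero) + (- c i₀) * a    ≡⟨ c′-sum _ ⟨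
        sum (λ l → c′ l * v l zero)                  ≡⟨ sum-zero c′v₀≡0 ⟩
        0ℚ                                           ∎))
        where
        open ≡-Reasoning
        c′v₀≡0 : ∀ l → c′ l * v l zero ≡ 0ℚ
        c′v₀≡0 l = trans (cong (_* v l zero) (c′≡0 l)) (ℚ.*-zeroˡ (v l zero))
      c≡0 : ∀ l → c l ≡ 0ℚ
      c≡0 l with l Fin.≟ i₀
      ... | yes refl  = c-i₀
      ... | no  l≢i₀ = trans (sym (c′-off l≢i₀)) (c′≡0 l)

    fromDependent : LinearlyDependent w S′ → LinearlyDependent v S
    fromDependent (e , e-supp , e-ann , l₀ , e-l₀≢0) = c , c-supp , c-ann , l₀ , c-l₀≢0
      where
      σ = sum (λ l → e l * v l zero)
      c = updateAt (λ l → a * e l) i₀ (_+ (- σ))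
      c-sum : ∀ x → sum (λ l → c l * x l) ≡ a * sum (λ l → e l * x l) + (- σ) * x i₀
      c-sum x = trans (∑-updateAt (λ l → a * e l) x i₀ (- σ)) (cong (_+ (- σ) * x i₀)
        (trans (sum-cong-≗ λ l → ℚ.*-assoc a (e l) (x l)) (sym (*-distribˡ-sum a (λ l → e l * x l)))))
      c-off : ∀ {l} → l ≢ i₀ → c l ≡ a * e l
      c-off l≢i₀ = updateAt-minimal _ i₀ _ l≢i₀
      c-supp : SupportedOn c S
      c-supp l l∉S = begin
        c l       ≡⟨ c-off l≢i₀ ⟩
        a * e l   ≡⟨ cong (a *_) (e-supp l (l∉S ∘ p─q⊆p S ⁅ i₀ ⁆)) ⟩
        a * 0ℚ    ≡⟨ ℚ.*-zeroʳ a ⟩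
        0ℚ        ∎
        where
        open ≡-Reasoning
        l≢i₀ : l ≢ i₀
        l≢i₀ refl = l∉S i₀∈S
      c-ann : Annihilates c v
      c-ann zero    = trans (c-sum _) (cancel a σ)
        where
        cancel : ∀ a σ → a * σ + (- σ) * a ≡ 0ℚ
        cancel = solve 2 (λ a σ → a :* σ :+ (:- σ) :* a := con 0ℚ) refl
      c-ann (suc j) = begin
        sum (λ l → c l * v l (suc j))  ≡⟨ c-sum _ ⟩
        s + (- σ) * v i₀ (suc j)       ≡⟨ cong (s +_) (swap σ (v i₀ (suc j))) ⟩
        s + (- v i₀ (suc j)) * σ       ≡⟨ w-combination e j ⟨
        sum (λ l → e l * w l j)        ≡⟨ e-ann j ⟩
        0ℚ                             ∎
        where
        open ≡-Reasoning
        s = a * sum (λ l → e l * v l (suc j))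
        swap : ∀ σ b → (- σ) * b ≡ (- b) * σ
        swap = solve 2 (λ σ b → (:- σ) :* b := (:- b) :* σ) refl
      l₀≢i₀ : l₀ ≢ i₀
      l₀≢i₀ refl = e-l₀≢0 (e-supp i₀ x∉p─⁅x⁆)
      c-l₀≢0 : c l₀ ≢ 0ℚ
      c-l₀≢0 c-l₀≡0 = e-l₀≢0 (*-zero-cancelˡ a≢0 (trans (sym (c-off l₀≢i₀)) c-l₀≡0))

  independent-or-dependent : ∀ {k} m (v : Fin k → Fin m → ℚ) S →
    LinearlyIndependent v S ⊎ LinearlyDependent v S
  independent-or-dependent zero v S with nonempty? S
  ... | yes (i , i∈S) = inj₂ (δ , δ-supp , (λ ()) , i , δ-i≢0)
    where
    δ = updateAt (λ _ → 0ℚ) i (λ _ → 1ℚ)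
    δ-supp : SupportedOn δ S
    δ-supp l l∉S = updateAt-minimal l i _ λ { refl → l∉S i∈S }
    δ-i≢0 : δ i ≢ 0ℚ
    δ-i≢0 δ-i≡0 with () ← trans (sym (updateAt-updates i _)) δ-i≡0
  ... | no  S-empty = inj₁ λ c c-supp _ i → c-supp i λ i∈S → S-empty (i , i∈S)
  independent-or-dependent (suc m) v S with any? (λ i → (i ∈? S) ×-dec ¬? (v i zero ≟ 0ℚ))
  ... | yes (i₀ , i₀∈S , a≢0) =
    Sum.map fromIndependent fromDependent (independent-or-dependent m w S′)
    where open Pivot v i₀∈S a≢0
  ... | no  no-pivot = Sum.map (λ ind c c-supp c-ann → ind c c-supp (c-ann ∘ suc)) extend
    (independent-or-dependent m (λ i j → v i (suc j)) S)
    where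
    column-zero : ∀ (c : Fin _ → ℚ) → SupportedOn c S → ∀ l → c l * v l zero ≡ 0ℚ
    column-zero c c-supp l with l ∈? S | v l zero ≟ 0ℚ
    ... | _      | yes vl≡0 = trans (cong (c l *_) vl≡0) (ℚ.*-zeroʳ (c l))
    ... | yes l∈S | no vl≢0 = contradiction (l , l∈S , vl≢0) no-pivot
    ... | no l∉S  | no _    = trans (cong (_* v l zero) (c-supp l l∉S)) (ℚ.*-zeroˡ (v l zero))
    extend : LinearlyDependent (λ i j → v i (suc j)) S → LinearlyDependent v S
    extend (c , c-supp , c-ann , i , c-i≢0) = c , c-supp , c-ann′ , i , c-i≢0
      where
      c-ann′ : Annihilates c v
      c-ann′ zero    = sum-zero (column-zero c c-supp)
      c-ann′ (suc j) = c-ann j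

  linearlyIndependent? : ∀ {k m} (v : Fin k → Fin m → ℚ) → Decidable (LinearlyIndependent v)
  linearlyIndependent? {m = m} v S with independent-or-dependent m v S
  ... | inj₁ ind = yes ind
  ... | inj₂ (c , c-supp , c-ann , i , c-i≢0) = no λ ind → c-i≢0 (ind c c-supp c-ann i)

  linearlyIndependent⇔rowsIndependent : ∀ {n} {M : Matrix n} {S} →
    LinearlyIndependent M S ⇔ RowsIndependent M S
  linearlyIndependent⇔rowsIndependent {M = M} = mk⇔
    (λ ind c c-supp c-ann → ind c c-supp (λ j → trans (sym (sumℚ≡sum (λ i → c i * M i j))) (c-ann j)))
    (λ ind c c-supp c-ann → ind c c-supp (λ j → trans (sumℚ≡sum (λ i → c i * M i j)) (c-ann j)))

  rank-exists : ∀ {n} (M : Matrix n) → ∃[ r ] IsRank M r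
  rank-exists M with largestSubset (λ S → Dec.map linearlyIndependent⇔rowsIndependent (linearlyIndependent? M S))
  ... | inj₁ none = contradiction (λ c c-supp _ i → c-supp i ∉⊥) (none ⊥)
  ... | inj₂ (S , S-ind , S-max) =
    ∣ S ∣ , (S , S-ind , refl) , λ { _ (S′ , S′-ind , refl) → S-max S′ S′-ind }

  module _ {k m} (A : Fin k → Fin m → ℚ) where

    J-A-annihilated : ∀ g → Annihilates g A → sum g ≡ 0ℚ → Annihilates g (λ i j → 1ℚ - A i j)
    J-A-annihilated g g-ann Σg≡0 j = begin
      sum (λ i → g i * (1ℚ - A i j))
        ≡⟨ sum-cong-≗ (λ i → expand (g i) (A i j)) ⟩
      sum (λ i → 1ℚ * g i + (- 1ℚ) * (g i * A i j))
        ≡⟨ ∑-linear 1ℚ (- 1ℚ) g (λ i → g i * A i j) ⟩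
      1ℚ * sum g + (- 1ℚ) * sum (λ i → g i * A i j)
        ≡⟨ cong₂ (λ x y → 1ℚ * x + (- 1ℚ) * y) Σg≡0 (g-ann j) ⟩
      0ℚ ∎
      where
      open ≡-Reasoning
      expand : ∀ g a → g * (1ℚ - a) ≡ 1ℚ * g + (- 1ℚ) * (g * a)
      expand = solve 2 (λ g a → g :* (con 1ℚ :- a) := con 1ℚ :* g :+ con (- 1ℚ) :* (g :* a)) refl

    rank[J-A]≤1+rank[A] : ∀ {S} → LinearlyIndependent (λ i j → 1ℚ - A i j) S →
      ∃[ S′ ] (LinearlyIndependent A S′ × ∣ S ∣ ℕ.≤ suc ∣ S′ ∣)
    rank[J-A]≤1+rank[A] {S} J-A-ind with independent-or-dependent m A S
    ... | inj₁ A-ind = S , A-ind , ℕ.n≤1+n _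
    ... | inj₂ (c , c-supp , c-ann , i₀ , c-i₀≢0) = S ─ ⁅ i₀ ⁆ , S─i₀-independent , card
      where
      i₀∈S : i₀ ∈ S
      i₀∈S with i₀ ∈? S
      ... | yes i₀∈S = i₀∈S
      ... | no  i₀∉S = contradiction (c-supp i₀ i₀∉S) c-i₀≢0
      card : ∣ S ∣ ℕ.≤ suc ∣ S ─ ⁅ i₀ ⁆ ∣
      card = ℕ.≤-reflexive (begin
        ∣ S ∣                        ≡⟨ ∣p─q∣+∣q∣≡∣p∣ ⁅i₀⁆⊆S ⟨
        ∣ S ─ ⁅ i₀ ⁆ ∣ ℕ.+ ∣ ⁅ i₀ ⁆ ∣  ≡⟨ cong (∣ S ─ ⁅ i₀ ⁆ ∣ ℕ.+_) (∣⁅x⁆∣≡1 i₀) ⟩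
        ∣ S ─ ⁅ i₀ ⁆ ∣ ℕ.+ 1          ≡⟨ ℕ.+-comm _ 1 ⟩
        suc ∣ S ─ ⁅ i₀ ⁆ ∣           ∎)
        where
        open ≡-Reasoning
        ⁅i₀⁆⊆S : ⁅ i₀ ⁆ ⊆ S
        ⁅i₀⁆⊆S i∈⁅i₀⁆ = subst (_∈ S) (sym (x∈⁅y⁆⇒x≡y i₀ i∈⁅i₀⁆)) i₀∈S
      σc≢0 : sum c ≢ 0ℚ
      σc≢0 σc≡0 = c-i₀≢0 (J-A-ind c c-supp (J-A-annihilated c c-ann σc≡0) i₀)
      -- a relation f among the rows of A in S ─ ⁅ i₀ ⁆ gives the relation (Σ c) f - (Σ f) c
      -- among the rows of J - A in S, which must vanish
      S─i₀-independent : LinearlyIndependent A (S ─ ⁅ i₀ ⁆)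
      S─i₀-independent f f-supp f-ann = f≡0
        where
        g = λ i → sum c * f i + (- sum f) * c i
        g≡0 : ∀ i → g i ≡ 0ℚ
        g≡0 = J-A-ind g g-supp (J-A-annihilated g g-ann g-sum)
          where
          g-supp : SupportedOn g S
          g-supp = SupportedOn-combination {f = f} {c} (sum c) (- sum f)
                     (SupportedOn-mono (p─q⊆p S ⁅ i₀ ⁆) f-supp) c-supp
          g-ann : Annihilates g A
          g-ann = Annihilates-combination {f = f} {c} (sum c) (- sum f) f-ann c-ann
          cancel : ∀ x y → x * y + (- y) * x ≡ 0ℚ
          cancel = solve 2 (λ x y → x :* y :+ (:- y) :* x := con 0ℚ) refl
          g-sum : sum g ≡ 0ℚ
          g-sum = trans (∑-linear (sum c) (- sum f) f c) (cancel (sum c) (sum f))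
        -σf≡0 : - sum f ≡ 0ℚ
        -σf≡0 = *-zero-cancelʳ c-i₀≢0 (begin
          (- sum f) * c i₀               ≡⟨ ℚ.+-identityˡ _ ⟨
          0ℚ + (- sum f) * c i₀          ≡⟨ cong (_+ (- sum f) * c i₀) (ℚ.*-zeroʳ (sum c)) ⟨
          sum c * 0ℚ + (- sum f) * c i₀  ≡⟨ cong (λ x → sum c * x + (- sum f) * c i₀) (f-supp i₀ x∉p─⁅x⁆) ⟨
          g i₀                           ≡⟨ g≡0 i₀ ⟩
          0ℚ                             ∎)
          where open ≡-Reasoning
        f≡0 : ∀ i → f i ≡ 0ℚ
        f≡0 i = *-zero-cancelˡ σc≢0 (begin
          sum c * f i             ≡⟨ ℚ.+-identityʳ _ ⟨
          sum c * f i + 0ℚ        ≡⟨ cong (sum c * f i +_) (ℚ.*-zeroˡ (c i)) ⟨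
          sum c * f i + 0ℚ * c i  ≡⟨ cong (λ x → sum c * f i + x * c i) -σf≡0 ⟨
          g i                     ≡⟨ g≡0 i ⟩
          0ℚ                      ∎)
          where open ≡-Reasoning

  rowSubmatrix-independent : ∀ {k m m′} (A : Fin k → Fin m → ℚ) (U : Subset k) (col : Fin m′ → Fin m) {S} →
    LinearlyIndependent (λ i j → A (embed U i) (col j)) S → LinearlyIndependent A (embedSubset U S)
  rowSubmatrix-independent A U col {S} sub-ind c c-supp c-ann u with u ∈? embedSubset U S
  ... | no  u∉ = c-supp u u∉
  ... | yes u∈ with embedSubset⁻ U S u∈
  ...   | i , _ , refl = sub-ind (c ∘ embed U) c∘embed-supp c∘embed-ann i
    where
    c∘embed-supp : SupportedOn (c ∘ embed U) S
    c∘embed-supp i i∉S = c-supp (embed U i) λ ei∈ → case embedSubset⁻ U S ei∈ of λ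
      { (i′ , i′∈S , ei′≡ei) → i∉S (subst (_∈ S) (embed-injective U ei′≡ei) i′∈S) }
    c∘embed-ann : Annihilates (c ∘ embed U) (λ i j → A (embed U i) (col j))
    c∘embed-ann j = trans (sym (sum-embed U (λ u → c u * A u (col j)) vanish)) (c-ann (col j))
      where
      vanish : ∀ u → u ∉ U → c u * A u (col j) ≡ 0ℚ
      vanish u u∉U =
        trans (cong (_* A u (col j)) (c-supp u (u∉U ∘ embedSubset⊆U U S))) (ℚ.*-zeroˡ (A u (col j)))


module RankBound where

  open Subsets
  open LinearAlgebra
  open import Data.Nat as ℕ using (suc)
  import Data.Nat.Properties as ℕ
  open import Data.Rational using (ℚ; 1ℚ; _-_)
  open import Data.Bool using (Bool; true; false; not; if_then_else_)
  open import Data.Bool.Properties using (not-involutive)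
  open import Data.Fin using (Fin; _≟_)
  open import Data.Fin.Subset using (Subset; ∣_∣)
  open import Function.Bundles using (Equivalence)
  open import Relation.Nullary using (yes; no; does; contradiction)
  open import Relation.Binary.PropositionalEquality

  module _ {n} (G : Graph n) (U : Subset n) where

    inducedAdjMatrix : Fin ∣ U ∣ → Fin ∣ U ∣ → ℚ
    inducedAdjMatrix i j = adjMatrix G (embed U i) (embed U j)

    complementAdj : Fin ∣ U ∣ → Fin ∣ U ∣ → Bool
    complementAdj i j = if does (i ≟ j) then false else not (adj G (embed U i) (embed U j))

    complementAdj-sym : ∀ i j → complementAdj i j ≡ complementAdj j i
    complementAdj-sym i j with i ≟ j | j ≟ i
    ... | yes _    | yes _    = refl
    ... | no  _    | no  _    = cong not (Graph.sym G (embed U i) (embed U j))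
    ... | yes refl | no  i≢i = contradiction refl i≢i
    ... | no  i≢i | yes refl = contradiction refl i≢i

    complementAdj-irrefl : ∀ i → complementAdj i i ≡ false
    complementAdj-irrefl i with i ≟ i
    ... | yes _   = refl
    ... | no  i≢i = contradiction refl i≢i

    inducedComplement : Graph ∣ U ∣
    inducedComplement = record { adj = complementAdj ; sym = complementAdj-sym ; irrefl = complementAdj-irrefl }

    adjMatrixPlusI-inducedComplement : ∀ i j →
      adjMatrixPlusI inducedComplement i j ≡ 1ℚ - inducedAdjMatrix i j
    adjMatrixPlusI-inducedComplement i j with i ≟ j
    ... | yes refl rewrite irrefl G (embed U i) = refl
    ... | no  _    with adj G (embed U i) (embed U j)
    ...   | true  = refl
    ...   | false = refl

    inducedComplement-clique⇒independent : ∀ {W} → Clique inducedComplement W →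
      Independent G (embedSubset U W)
    inducedComplement-clique⇒independent {W} clique u u′ u∈ u′∈
      with embedSubset⁻ U W u∈ | embedSubset⁻ U W u′∈
    ... | i , i∈W , refl | i′ , i′∈W , refl with i ≟ i′ | clique i i′ i∈W i′∈W
    ...   | yes refl | _         = irrefl G (embed U i)
    ...   | no  i≢i′ | adjacent = trans (sym (not-involutive _)) (cong not (adjacent i≢i′))

    inducedComplement-cliqueNumber : ∀ {d} → InducedIndepAtMost G U d → CliqueNumberAtMost inducedComplement d
    inducedComplement-cliqueNumber {d} α[U]≤d W clique = subst (_≤ d) (∣embedSubset∣≡∣W∣ U W)
      (α[U]≤d (embedSubset U W) (embedSubset⊆U U W) (inducedComplement-clique⇒independent clique))

    rank[inducedComplement+I]≤1+rank : ∀ {r r′} → IsRank (adjMatrix G) r →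
      IsRank (adjMatrixPlusI inducedComplement) r′ → r′ ℕ.≤ suc r
    rank[inducedComplement+I]≤1+rank {r} (_ , rank-max) ((S , S-ind , refl) , _)
      with rank[J-A]≤1+rank[A] inducedAdjMatrix (LinearlyIndependent-cong adjMatrixPlusI-inducedComplement
             (Equivalence.from linearlyIndependent⇔rowsIndependent S-ind))
    ... | S′ , S′-ind , S≤1+S′ = ℕ.≤-trans S≤1+S′ (ℕ.s≤s (rank-max ∣ S′ ∣ (embedSubset U S′ , S′-rows , ∣embedSubset∣≡∣W∣ U S′)))
      where
      S′-rows = Equivalence.to linearlyIndependent⇔rowsIndependent
                  (rowSubmatrix-independent (adjMatrix G) U (embed U) S′-ind)

  rank-bound : ∀ {n} (G : Graph n) {r d p v} →
    IsRank (adjMatrix G) r → IsPsi G d p → IsNu d p v → v ∸ 1 ≤ r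
  rank-bound G rank≡r ((U , α[U]≤d , refl) , _) (_ , ν-min)
    with rank-exists (adjMatrixPlusI (inducedComplement G U))
  ... | r′ , rank-H≡r′ = ℕ.∸-monoˡ-≤ 1 (ℕ.≤-trans
    (ν-min r′ (inducedComplement G U , inducedComplement-cliqueNumber G U α[U]≤d , rank-H≡r′))
    (rank[inducedComplement+I]≤1+rank G U rank≡r rank-H≡r′))

open GreedyColouring using (chromatic-bound)
open RankBound using (rank-bound)

corollary3p4 : ∀ {n} (G : Graph n) → 1 ≤ n →
    ∀ a c r → IsIndependenceNumber G a → IsChromaticNumber G c →
    IsRank (adjMatrix G) r →
    ∃[ d ] (1 ≤ d × d ≤ a ×
      (∀ p → IsPsi G d p →
        LnBound n c d p × (∀ v → IsNu d p v → v ∸ 1 ≤ r)))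
corollary3p4 G 1≤n a c r α≡a χ≡c rank≡r with chromatic-bound G 1≤n α≡a χ≡c
... | d , 1≤d , d≤a , ln-bound =
  d , 1≤d , d≤a , λ p ψ≡p → ln-bound p ψ≡p , λ v ν≡v → rank-bound G rank≡r ψ≡p ν≡v
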